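{- Let $D$ be a commutative ring containing a unit $\varepsilon$ such that $\varepsilon-\varepsilon^{ -1}$ is also a unit. Then: (a) for every $t\in D$ there exist $X,Y\in\operatorname{SL}_2(D)$ with $\operatorname{Tr}(XYX^{ -1}Y^{ -1})=t$; and (b) for every $k\in D$ there exists $(x_1,x_2,x_3)\in D^3$ with $x_1^2+x_2^2+x_3^2-x_1x_2x_3=k$. -}

module Defs where

open import Level using (Level)
open import Algebra.Bundles using (CommutativeRing)
open import Data.Product using (Σ; ∃; _×_; _,_)

module _ {c ℓ : Level} (R : CommutativeRing c ℓ) where
  open CommutativeRing R

  -- x is a unit of R with (two-sided, R commutative) inverse y
  IsInverse : Carrier → Carrier → Set ℓ
  IsInverse x y = x * y ≈ 1#

  IsUnit : Carrier → Set (c Level.⊔ ℓ)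
  IsUnit x = Σ Carrier (λ y → IsInverse x y)

  record Mat2 : Set c where
    constructor mat
    field
      m11 m12 m21 m22 : Carrier

  open Mat2 public

  _⊗_ : Mat2 → Mat2 → Mat2
  A ⊗ B = mat (m11 A * m11 B + m12 A * m21 B) (m11 A * m12 B + m12 A * m22 B)
              (m21 A * m11 B + m22 A * m21 B) (m21 A * m12 B + m22 A * m22 B)

  det : Mat2 → Carrier
  det A = m11 A * m22 A - m12 A * m21 A

  tr : Mat2 → Carrier
  tr A = m11 A + m22 A

  record SL2 : Set (c Level.⊔ ℓ) where
    constructor sl2
    field
      matrix : Mat2
      det≈1  : det matrix ≈ 1#

  open SL2 public

  -- inverse of a determinant-one matrix: its adjugate ( d -b ; -c a )
  inv : SL2 → Mat2
  inv X = let A = matrix X in mat (m22 A) (- m12 A) (- m21 A) (m11 A)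

  commutator : SL2 → SL2 → Mat2
  commutator X Y = ((matrix X ⊗ matrix Y) ⊗ inv X) ⊗ inv Y

{-# OPTIONS --safe #-}
-- Conjugating Y = ( a b ; c d ) ∈ SL₂ by X = diag(λ, λ⁻¹) multiplies b by λ² and c by λ⁻²,
-- which gives tr [X, Y] = 2 − bc (λ − λ⁻¹)².  As bc can be any element and λ − λ⁻¹ is a
-- unit for λ = ε, every element is the trace of a commutator.  Part (b) then follows from
-- Fricke's identity tr [X, Y] + 2 = x² + y² + z² − xyz, where x = tr X, y = tr Y, z = tr XY.
module Submission where

open import Defs

open import Level using (Level)
open import Algebra.Bundles using (CommutativeRing)
open import Data.Product using (Σ; _×_; _,_)
open import Data.Maybe using (map)
open import Data.Nat as ℕ using (ℕ; zero; suc)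
open import Data.Integer as ℤ using (ℤ; +_; -[1+_]; _⊖_)
import Data.Integer.Properties as ℤ
import Data.Nat.Properties as ℕ
open import Data.Sign as Sign using (Sign)
open import Relation.Binary.Consequences using (dec⇒weaklyDec)
open import Relation.Binary.Definitions using (WeaklyDecidable)
import Relation.Binary.PropositionalEquality as ≡
open import Algebra.Solver.Ring.AlmostCommutativeRing
  using (fromCommutativeRing; _-Raw-AlmostCommutative⟶_)
import Algebra.Solver.Ring

-- The solver can only cancel monomials if coefficient equality is decidable, so identities
-- are normalised over ℤ and interpreted along the canonical map ℤ → R.
module IntegerCoefficientSolver {c ℓ : Level} (R : CommutativeRing c ℓ) where
  open CommutativeRing R
  open import Relation.Binary.Reasoning.Setoid setoid
  open import Algebra.Properties.Semiring.Mult semiring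
    using (×-congˡ; ×-homo-+; ×1-homo-*) renaming (_×_ to _×ₙ_)
  open import Algebra.Properties.Ring ring using (-1*x≈-x; -0#≈0#)
  open import Algebra.Properties.AbelianGroup +-abelianGroup using (⁻¹-∙-comm)
  open import Algebra.Properties.Group +-group using (⁻¹-involutive)
  open import Algebra.Properties.CommutativeSemigroup +-commutativeSemigroup
    using () renaming (interchange to +-interchange)
  open import Algebra.Properties.CommutativeSemigroup *-commutativeSemigroup
    using () renaming (interchange to *-interchange)

  ⟦_⟧ℤ : ℤ → Carrier
  ⟦ + n ⟧ℤ = n ×ₙ 1#
  ⟦ -[1+ n ] ⟧ℤ = - (suc n ×ₙ 1#)

  ⟦_⟧ˢ : Sign → Carrier
  ⟦ Sign.+ ⟧ˢ = 1#
  ⟦ Sign.- ⟧ˢ = - 1#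

  1+x-[1+y]≈x-y : ∀ x y → (1# + x) - (1# + y) ≈ x - y
  1+x-[1+y]≈x-y x y = begin
    (1# + x) - (1# + y)      ≈⟨ +-congˡ (⁻¹-∙-comm 1# y) ⟨
    (1# + x) + (- 1# + - y)  ≈⟨ +-interchange 1# x (- 1#) (- y) ⟩
    (1# - 1#) + (x - y)      ≈⟨ +-congʳ (-‿inverseʳ 1#) ⟩
    0# + (x - y)             ≈⟨ +-identityˡ (x - y) ⟩
    x - y                    ∎

  ⊖-homo : ∀ m n → ⟦ m ⊖ n ⟧ℤ ≈ m ×ₙ 1# - n ×ₙ 1#
  ⊖-homo m       zero    = sym (trans (+-congˡ -0#≈0#) (+-identityʳ _))
  ⊖-homo zero    (suc n) = sym (+-identityˡ _)
  ⊖-homo (suc m) (suc n) rewrite ℤ.[1+m]⊖[1+n]≡m⊖n m n =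
    trans (⊖-homo m n) (sym (1+x-[1+y]≈x-y (m ×ₙ 1#) (n ×ₙ 1#)))

  +-homo : ∀ i j → ⟦ i ℤ.+ j ⟧ℤ ≈ ⟦ i ⟧ℤ + ⟦ j ⟧ℤ
  +-homo (+ m)     (+ n)     = ×-homo-+ 1# m n
  +-homo (+ m)     -[1+ n ]  = ⊖-homo m (suc n)
  +-homo -[1+ m ]  (+ n)     = trans (⊖-homo n (suc m)) (+-comm _ _)
  +-homo -[1+ m ]  -[1+ n ]  = begin
    - (suc (suc (m ℕ.+ n)) ×ₙ 1#)       ≈⟨ -‿cong (×-congˡ (≡.cong suc (ℕ.+-suc m n))) ⟨
    - ((suc m ℕ.+ suc n) ×ₙ 1#)         ≈⟨ -‿cong (×-homo-+ 1# (suc m) (suc n)) ⟩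
    - (suc m ×ₙ 1# + suc n ×ₙ 1#)        ≈⟨ ⁻¹-∙-comm (suc m ×ₙ 1#) (suc n ×ₙ 1#) ⟨
    - (suc m ×ₙ 1#) + - (suc n ×ₙ 1#)    ∎

  -‿homo : ∀ i → ⟦ ℤ.- i ⟧ℤ ≈ - ⟦ i ⟧ℤ
  -‿homo (+ zero)  = sym -0#≈0#
  -‿homo (+ suc n) = refl
  -‿homo -[1+ n ]  = sym (⁻¹-involutive _)

  ◃-homo : ∀ s n → ⟦ s ℤ.◃ n ⟧ℤ ≈ ⟦ s ⟧ˢ * (n ×ₙ 1#)
  ◃-homo s        zero    = sym (zeroʳ _)
  ◃-homo Sign.+  (suc n) = sym (*-identityˡ _)
  ◃-homo Sign.-  (suc n) = sym (-1*x≈-x _)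

  sign-homo : ∀ s t → ⟦ s Sign.* t ⟧ˢ ≈ ⟦ s ⟧ˢ * ⟦ t ⟧ˢ
  sign-homo Sign.+ t      = sym (*-identityˡ _)
  sign-homo Sign.- Sign.+ = sym (*-identityʳ _)
  sign-homo Sign.- Sign.- = sym (trans (-1*x≈-x _) (⁻¹-involutive _))

  sign◃abs : ∀ i → ⟦ i ⟧ℤ ≈ ⟦ ℤ.sign i ⟧ˢ * (ℤ.∣ i ∣ ×ₙ 1#)
  sign◃abs (+ n)     = sym (*-identityˡ _)
  sign◃abs -[1+ n ]  = sym (-1*x≈-x _)

  *-homo : ∀ i j → ⟦ i ℤ.* j ⟧ℤ ≈ ⟦ i ⟧ℤ * ⟦ j ⟧ℤ
  *-homo i j = begin
    ⟦ i ℤ.* j ⟧ℤ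
      ≈⟨ ◃-homo (ℤ.sign i Sign.* ℤ.sign j) (ℤ.∣ i ∣ ℕ.* ℤ.∣ j ∣) ⟩
    ⟦ ℤ.sign i Sign.* ℤ.sign j ⟧ˢ * ((ℤ.∣ i ∣ ℕ.* ℤ.∣ j ∣) ×ₙ 1#)
      ≈⟨ *-cong (sign-homo (ℤ.sign i) (ℤ.sign j)) (×1-homo-* ℤ.∣ i ∣ ℤ.∣ j ∣) ⟩
    (⟦ ℤ.sign i ⟧ˢ * ⟦ ℤ.sign j ⟧ˢ) * ((ℤ.∣ i ∣ ×ₙ 1#) * (ℤ.∣ j ∣ ×ₙ 1#))
      ≈⟨ *-interchange _ _ _ _ ⟩
    (⟦ ℤ.sign i ⟧ˢ * (ℤ.∣ i ∣ ×ₙ 1#)) * (⟦ ℤ.sign j ⟧ˢ * (ℤ.∣ j ∣ ×ₙ 1#))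
      ≈⟨ *-cong (sign◃abs i) (sign◃abs j) ⟨
    ⟦ i ⟧ℤ * ⟦ j ⟧ℤ
      ∎

  ℤ⟶R : ℤ.+-*-rawRing -Raw-AlmostCommutative⟶ fromCommutativeRing R
  ℤ⟶R = record
    { ⟦_⟧    = ⟦_⟧ℤ
    ; +-homo = +-homo
    ; *-homo = *-homo
    ; -‿homo = -‿homo
    ; 0-homo = refl
    ; 1-homo = +-identityʳ 1#
    }

  ⟦⟧ℤ-≟ : WeaklyDecidable (λ i j → ⟦ i ⟧ℤ ≈ ⟦ j ⟧ℤ)
  ⟦⟧ℤ-≟ i j = map (λ i≡j → reflexive (≡.cong ⟦_⟧ℤ i≡j)) (dec⇒weaklyDec ℤ._≟_ i j)

  open Algebra.Solver.Ring ℤ.+-*-rawRing (fromCommutativeRing R) ℤ⟶R ⟦⟧ℤ-≟ public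

module SL2Traces {c ℓ : Level} (D : CommutativeRing c ℓ) where
  open CommutativeRing D
  open import Relation.Binary.Reasoning.Setoid setoid
  open import Algebra.Properties.Group +-group using (//-rightDividesˡ; //-rightDividesʳ)
  open IntegerCoefficientSolver D
    using (⟦_⟧ℤ; Polynomial; con; _:+_; _:-_; :-_; _:*_; _:=_; solve)

  -- The matrix operations of Defs on solver syntax: ⟦ ptr (pcommutator A B) ⟧ computes to
  -- tr (commutator X Y), so identities about traces need not be expanded entrywise.
  record PolynomialMatrix (n : ℕ) : Set where
    constructor pmat
    field p₁₁ p₁₂ p₂₁ p₂₂ : Polynomial n

  module _ {n : ℕ} where
    open PolynomialMatrix

    _⊠_ : PolynomialMatrix n → PolynomialMatrix n → PolynomialMatrix n
    A ⊠ B = pmat (p₁₁ A :* p₁₁ B :+ p₁₂ A :* p₂₁ B) (p₁₁ A :* p₁₂ B :+ p₁₂ A :* p₂₂ B)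
                 (p₂₁ A :* p₁₁ B :+ p₂₂ A :* p₂₁ B) (p₂₁ A :* p₁₂ B :+ p₂₂ A :* p₂₂ B)

    ptr pdet : PolynomialMatrix n → Polynomial n
    ptr A = p₁₁ A :+ p₂₂ A
    pdet A = p₁₁ A :* p₂₂ A :- p₁₂ A :* p₂₁ A

    padj : PolynomialMatrix n → PolynomialMatrix n
    padj A = pmat (p₂₂ A) (:- p₁₂ A) (:- p₂₁ A) (p₁₁ A)

    pcommutator : PolynomialMatrix n → PolynomialMatrix n → PolynomialMatrix n
    pcommutator A B = ((A ⊠ B) ⊠ padj A) ⊠ padj B

  -- Not 1# + 1#: this way 2# is definitionally the meaning of the solver constant con (+ 2).
  2# : Carrier
  2# = ⟦ + 2 ⟧ℤ

  fricke-identity : (X Y : SL2 D) →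
    let A = matrix X ; B = matrix Y
        x = tr D A ; y = tr D B ; z = tr D (_⊗_ D A B)
    in tr D (commutator D X Y) + 2# * (det D A * det D B)
       ≈ x * x * det D B + y * y * det D A + z * z - x * y * z
  fricke-identity (sl2 (mat a b c d) _) (sl2 (mat e f g h) _) =
    solve 8 (λ a b c d e f g h →
      let A = pmat a b c d ; B = pmat e f g h
          x = ptr A ; y = ptr B ; z = ptr (A ⊠ B)
      in ptr (pcommutator A B) :+ con (+ 2) :* (pdet A :* pdet B)
         := x :* x :* pdet B :+ y :* y :* pdet A :+ z :* z :- x :* y :* z)
      refl a b c d e f g h

  fricke : Carrier → Carrier → Carrier → Carrier
  fricke x y z = x * x + y * y + z * z - x * y * z

  tr-commutator+2≈fricke : (X Y : SL2 D) →
    let A = matrix X ; B = matrix Y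
    in tr D (commutator D X Y) + 2# ≈ fricke (tr D A) (tr D B) (tr D (_⊗_ D A B))
  tr-commutator+2≈fricke X Y = begin
    tr D (commutator D X Y) + 2#
      ≈⟨ +-congˡ 2#*[1*1]≈2# ⟨
    tr D (commutator D X Y) + 2# * (det D A * det D B)
      ≈⟨ fricke-identity X Y ⟩
    x * x * det D B + y * y * det D A + z * z - x * y * z
      ≈⟨ +-congʳ (+-congʳ (+-cong (times-det≈1 Y) (times-det≈1 X))) ⟩
    fricke x y z
      ∎
    where
    A = matrix X ; B = matrix Y
    x = tr D A ; y = tr D B ; z = tr D (_⊗_ D A B)
    2#*[1*1]≈2# : 2# * (det D A * det D B) ≈ 2#
    2#*[1*1]≈2# = trans (*-congˡ (trans (*-cong (det≈1 X) (det≈1 Y)) (*-identityˡ 1#))) (*-identityʳ 2#)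
    times-det≈1 : ∀ (Z : SL2 D) {w} → w * det D (matrix Z) ≈ w
    times-det≈1 Z = trans (*-congˡ (det≈1 Z)) (*-identityʳ _)

  diagonal : (λ₁ λ₂ : Carrier) → λ₁ * λ₂ ≈ 1# → SL2 D
  diagonal λ₁ λ₂ λ₁λ₂≈1 = sl2 (mat λ₁ 0# 0# λ₂) (trans det≈λ₁λ₂ λ₁λ₂≈1)
    where
    det≈λ₁λ₂ : λ₁ * λ₂ - 0# * 0# ≈ λ₁ * λ₂
    det≈λ₁λ₂ = solve 2 (λ l m → l :* m :- con (+ 0) :* con (+ 0) := l :* m) refl λ₁ λ₂

  tr-commutator-diagonal : ∀ λ₁ λ₂ (λ₁λ₂≈1 : λ₁ * λ₂ ≈ 1#) (Y : SL2 D) →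
    tr D (commutator D (diagonal λ₁ λ₂ λ₁λ₂≈1) Y)
      ≈ 2# - m12 (matrix Y) * m21 (matrix Y) * ((λ₁ - λ₂) * (λ₁ - λ₂))
  tr-commutator-diagonal λ₁ λ₂ λ₁λ₂≈1 Y@(sl2 B@(mat a b c d) detB≈1) = begin
    tr D (commutator D (diagonal λ₁ λ₂ λ₁λ₂≈1) Y)
      ≈⟨ diagonal-identity ⟩
    2# * (λ₁ * λ₂) * det D B - b * c * ((λ₁ - λ₂) * (λ₁ - λ₂))
      ≈⟨ +-congʳ (trans (*-cong (*-congˡ λ₁λ₂≈1) detB≈1) (trans (*-identityʳ _) (*-identityʳ 2#))) ⟩
    2# - b * c * ((λ₁ - λ₂) * (λ₁ - λ₂))
      ∎
    where
    diagonal-identity : tr D (commutator D (diagonal λ₁ λ₂ λ₁λ₂≈1) Y)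
      ≈ 2# * (λ₁ * λ₂) * det D B - b * c * ((λ₁ - λ₂) * (λ₁ - λ₂))
    diagonal-identity =
      solve 6 (λ l m a b c d →
        let A = pmat l (con (+ 0)) (con (+ 0)) m ; B = pmat a b c d
        in ptr (pcommutator A B) := con (+ 2) :* (l :* m) :* pdet B :- b :* c :* ((l :- m) :* (l :- m)))
        refl λ₁ λ₂ a b c d

  -- ( 1 0 ; 1 1 ) ( 1 s ; 0 1 ), whose off-diagonal entries multiply to s.
  elementaryProduct : Carrier → SL2 D
  elementaryProduct s = sl2 (mat 1# s 1# (1# + s)) 1+s-s≈1
    where
    1+s-s≈1 : 1# * (1# + s) - s * 1# ≈ 1#
    1+s-s≈1 = trans (+-cong (*-identityˡ (1# + s)) (-‿cong (*-identityʳ s))) (//-rightDividesʳ s 1#)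

  commutator-trace-surjective : (ε ε⁻¹ : Carrier) → IsInverse D ε ε⁻¹ → IsUnit D (ε - ε⁻¹) →
    (t : Carrier) → Σ (SL2 D) (λ X → Σ (SL2 D) (λ Y → tr D (commutator D X Y) ≈ t))
  commutator-trace-surjective ε ε⁻¹ εε⁻¹≈1 (δ , uδ≈1) t = X , Y , (begin
    tr D (commutator D X Y)  ≈⟨ tr-commutator-diagonal ε ε⁻¹ εε⁻¹≈1 Y ⟩
    2# - s * 1# * (u * u)    ≈⟨ +-congˡ (-‿cong s*1*u²≈2-t) ⟩
    2# - (2# - t)            ≈⟨ solve 2 (λ x y → x :- (x :- y) := y) refl 2# t ⟩
    t                        ∎)
    where
    u = ε - ε⁻¹
    s = (2# - t) * (δ * δ)
    X = diagonal ε ε⁻¹ εε⁻¹≈1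
    Y = elementaryProduct s
    s*1*u²≈2-t : s * 1# * (u * u) ≈ 2# - t
    s*1*u²≈2-t = begin
      (2# - t) * (δ * δ) * 1# * (u * u)
        -- 1# is a variable o here, since the solver's con (+ 1) means 1# + 0#.
        ≈⟨ solve 4 (λ r δ u o → r :* (δ :* δ) :* o :* (u :* u) := r :* ((u :* δ) :* (u :* δ)) :* o)
                   refl (2# - t) δ u 1# ⟩
      (2# - t) * ((u * δ) * (u * δ)) * 1#
        ≈⟨ *-congʳ (*-congˡ (trans (*-cong uδ≈1 uδ≈1) (*-identityˡ 1#))) ⟩
      (2# - t) * 1# * 1#
        ≈⟨ trans (*-identityʳ _) (*-identityʳ _) ⟩
      2# - t
        ∎

  fricke-surjective :
    ((t : Carrier) → Σ (SL2 D) (λ X → Σ (SL2 D) (λ Y → tr D (commutator D X Y) ≈ t))) →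
    (k : Carrier) → Σ Carrier (λ x → Σ Carrier (λ y → Σ Carrier (λ z → fricke x y z ≈ k)))
  fricke-surjective surjective k with surjective (k - 2#)
  ... | X , Y , tr≈k-2 = tr D A , tr D B , tr D (_⊗_ D A B) , (begin
    fricke (tr D A) (tr D B) (tr D (_⊗_ D A B))  ≈⟨ tr-commutator+2≈fricke X Y ⟨
    tr D (commutator D X Y) + 2#                  ≈⟨ +-congʳ tr≈k-2 ⟩
    k - 2# + 2#                                   ≈⟨ //-rightDividesˡ 2# k ⟩
    k                                             ∎)
    where
    A = matrix X
    B = matrix Y

proposition4p2 : {c ℓ : Level} (D : CommutativeRing c ℓ) →
    let open CommutativeRing D in
    (ε ε⁻¹ : Carrier) → IsInverse D ε ε⁻¹ → IsUnit D (ε - ε⁻¹) →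
    ((t : Carrier) → Σ (SL2 D) (λ X → Σ (SL2 D) (λ Y → tr D (commutator D X Y) ≈ t)))
    × ((k : Carrier) → Σ Carrier (λ x₁ → Σ Carrier (λ x₂ → Σ Carrier (λ x₃ →
        x₁ * x₁ + x₂ * x₂ + x₃ * x₃ - x₁ * x₂ * x₃ ≈ k))))
proposition4p2 D ε ε⁻¹ εε⁻¹≈1 ε-ε⁻¹-unit = surjective , fricke-surjective surjective
  where
  open SL2Traces D
  surjective = commutator-trace-surjective ε ε⁻¹ εε⁻¹≈1 ε-ε⁻¹-unit
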